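{- Let $H$ be a strictly $2$-balanced graph with $1 < m_2(H) < \frac{\delta(H)(\delta(H)+1)}{2\delta(H)+1}$. Then every graph $B$ with $m(B) \le m_2(H)$ satisfies $B \not\xrightarrow{\mathrm{a-ram}} H$, i.e. $B$ has a proper edge-colouring with no rainbow copy of $H$.
   Context: $\delta(H)$ is the minimum degree of $H$. $G \xrightarrow{\mathrm{a-ram}} H$ means every proper edge-colouring of $G$ contains a rainbow copy of $H$ (a subgraph isomorphic to $H$ with pairwise distinct edge colours). $m(B) = \max\{e(J)/v(J) : J \subseteq B,\ v(J)\ge 1\}$. For a graph $J$, $d_2(J) = \frac{e(J)-1}{v(J)-2}$ if $e(J)\ge 1$ and $v(J)\ge 3$, $d_2(K_2) = 1/2$, and $d_2(J)=0$ otherwise; $m_2(H) = \max\{d_2(J) : J \subseteq H\}$. $H$ is strictly $2$-balanced if $d_2(J) < d_2(H)$ for every proper subgraph $J \subsetneq H$. -}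

module Defs where

open import Data.Bool using (Bool; true; false; if_then_else_; _∧_)
open import Data.Nat using (ℕ; zero; suc; _+_; _*_; _∸_; _⊓_; _<ᵇ_; _≤_)
open import Data.Fin using (Fin; toℕ)
open import Data.List using (List; map; allFin; foldr)
open import Data.Nat.ListAction using (sum)
open import Data.Integer using (+_)
open import Data.Rational using (ℚ; _/_; 0ℚ)
import Data.Rational as Q
open import Data.Product using (Σ; ∃; _×_; _,_)
open import Data.Sum using (_⊎_)
open import Relation.Binary.PropositionalEquality using (_≡_; _≢_)
open import Relation.Nullary using (¬_)

sumFin : {n : ℕ} → (Fin n → ℕ) → ℕ
sumFin {n} f = sum (map f (allFin n))

record Graph : Set where
  field
    n     : ℕ
    adj   : Fin n → Fin n → Bool
    sym   : ∀ i j → adj i j ≡ adj j i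
    irref : ∀ i → adj i i ≡ false
open Graph public

vG : Graph → ℕ
vG G = n G

eG : Graph → ℕ
eG G = sumFin (λ i → sumFin (λ j → if (toℕ i <ᵇ toℕ j) ∧ adj G i j then 1 else 0))

record Subgraph (G : Graph) : Set where
  field
    vs    : Fin (n G) → Bool
    es    : Fin (n G) → Fin (n G) → Bool
    es⊆   : ∀ i j → es i j ≡ true → adj G i j ≡ true
    esSym : ∀ i j → es i j ≡ es j i
    esV   : ∀ i j → es i j ≡ true → (vs i ≡ true × vs j ≡ true)
open Subgraph public

vS : {G : Graph} → Subgraph G → ℕ
vS J = sumFin (λ i → if vs J i then 1 else 0)

eS : {G : Graph} → Subgraph G → ℕ
eS J = sumFin (λ i → sumFin (λ j → if (toℕ i <ᵇ toℕ j) ∧ es J i j then 1 else 0))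

ProperSub : {G : Graph} → Subgraph G → Set
ProperSub {G} J = (∃ λ i → vs J i ≡ false) ⊎ (∃ λ i → ∃ λ j → adj G i j ≡ true × es J i j ≡ false)

-- d₂ from (number of vertices, number of edges):
-- (e-1)/(v-2) if e ≥ 1 and v ≥ 3; 1/2 for K₂ (v = 2, e = 1); 0 otherwise.
d₂ : ℕ → ℕ → ℚ
d₂ (suc (suc (suc k))) (suc e) = + e / suc k
d₂ 2 1 = + 1 / 2
d₂ _ _ = 0ℚ

-- e/v for v ≥ 1 (only used when v ≥ 1)
density : ℕ → ℕ → ℚ
density zero e = 0ℚ
density (suc k) e = + e / suc k

IsM2 : Graph → ℚ → Set
IsM2 H q = (∃ λ (J : Subgraph H) → d₂ (vS J) (eS J) ≡ q)
         × (∀ (J : Subgraph H) → d₂ (vS J) (eS J) Q.≤ q)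

MDensityAtMost : Graph → ℚ → Set
MDensityAtMost B q = ∀ (J : Subgraph B) → 1 ≤ vS J → density (vS J) (eS J) Q.≤ q

Strictly2Balanced : Graph → Set
Strictly2Balanced H = ∀ (J : Subgraph H) → ProperSub J → d₂ (vS J) (eS J) Q.< d₂ (vG H) (eG H)

-- degree and minimum degree δ(H) (δ of the empty graph is taken to be 0)
deg : (G : Graph) → Fin (n G) → ℕ
deg G i = sumFin (λ j → if adj G i j then 1 else 0)

minDeg : Graph → ℕ
minDeg G = foldr (λ i m → deg G i ⊓ m) (n G) (allFin (n G))

bound : ℕ → ℚ
bound d = + (d * suc d) / suc (2 * d)

Colouring : Graph → Set
Colouring G = Fin (n G) → Fin (n G) → ℕ

ProperColouring : (G : Graph) → Colouring G → Set
ProperColouring G c =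
  (∀ u v → adj G u v ≡ true → c u v ≡ c v u)
  × (∀ u v w → adj G u v ≡ true → adj G u w ≡ true → v ≢ w → c u v ≢ c u w)

RainbowCopy : (G H : Graph) → Colouring G → Set
RainbowCopy G H c = Σ (Fin (n H) → Fin (n G)) λ φ →
    (∀ i j → φ i ≡ φ j → i ≡ j)
  × (∀ i j → adj H i j ≡ true → adj G (φ i) (φ j) ≡ true)
  × (∀ i j k l → adj H i j ≡ true → adj H k l ≡ true →
       c (φ i) (φ j) ≡ c (φ k) (φ l) → (i ≡ k × j ≡ l) ⊎ (i ≡ l × j ≡ k))

ARam : Graph → Graph → Set
ARam G H = ∀ (c : Colouring G) → ProperColouring G c → RainbowCopy G H c

-- Peel B, keeping a set S of unpeeled vertices and a proper colouring in which every edge inside S has a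
-- colour of its own, while every copy of H that leaves S already has two edges of equal colour, each with
-- an end outside S (so recolouring edges inside S never repairs it).  Start from a rainbow colouring and
-- S = V(B); let δ = δ(H).
--  * A vertex of degree < δ in S lies in no copy of H inside S: drop it.
--  * Let uv be an edge whose ends both have degree exactly δ in S.  A copy of H inside S through u or v
--    contains every S-neighbour of u and of v.  So if u has a neighbour x ≠ v and v a neighbour y ∉ {u, x},
--    giving vy the colour of ux (used nowhere else) spoils every copy through u or v: drop u and v.
--    Otherwise δ = 2 and u, v have a common neighbour y; as m₂(H) < 6/5, H has no triangle, so no copy
--    passes through u: drop u.
-- Peeling never gets stuck: if all degrees in S are ≥ δ and the vertices of degree δ are independent,
-- counting edge ends gives e(S)/|S| ≥ δ(δ+1)/(2δ+1) > m₂(H) ≥ m(B).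
module Submission where

open import Defs renaming (sym to adj-sym; irref to adj-irrefl)

open import Data.Bool using (Bool; true; false; if_then_else_; _∧_; _∨_; not)
import Data.Bool as Bool
open import Data.Bool.Properties using (∧-conicalˡ; ∧-conicalʳ; ∧-zeroʳ; ∧-identityʳ; ¬-not)
open import Data.Empty using (⊥; ⊥-elim)
open import Data.Fin using (Fin; toℕ; combine) renaming (zero to fzero; suc to fsuc)
open import Data.Fin.Properties using (_≟_; any?)
import Data.Fin.Properties as Fin
import Data.Integer as ℤ
open import Data.Integer.Properties using (pos-*; drop‿+<+)
open import Data.List using (List; _∷_; allFin; tabulate; foldr)
open import Data.List.Membership.Propositional using (_∈_)
open import Data.List.Membership.Propositional.Properties using (∈-allFin)
open import Data.List.Properties using (map-tabulate)
open import Data.List.Relation.Unary.Any using (here; there)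
open import Data.Nat using (ℕ; zero; suc; pred; _+_; _*_; _⊓_; _<ᵇ_; _≤_; _<_; z≤n; s≤s)
import Data.Nat.ListAction as List
open import Data.Nat.Properties
  using ( +-*-semiring; +-comm; +-identityʳ; *-comm; *-identityʳ; *-zeroʳ; ⊓-comm; ⊓-sel; m⊓n≤m; m⊓n≤n
        ; ≤-refl; ≤-reflexive; ≤-trans; ≤-antisym; <-irrefl; <-asym; ≤-<-trans; ≮⇒≥; ≤∧≢⇒<; m≤m+n
        ; +-mono-≤; +-monoʳ-≤; *-monoʳ-≤; *-cancelˡ-≤; *-cancelˡ-≡; <ᵇ-reflects-<; module ≤-Reasoning )
import Data.Nat.Properties as ℕ
open import Algebra.Properties.Semiring.Sum +-*-semiring
  using (sum; ∑-distrib-+; ∑-comm; *-distribˡ-sum; sum-cong-≗; sum-replicate-zero)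
open import Data.Nat.Tactic.RingSolver using (solve-∀)
open import Data.Product using (∃; ∃₂; _×_; _,_; proj₁; proj₂)
import Data.Rational as ℚ
open ℚ using (ℚ; 1ℚ; _/_)
import Data.Rational.Properties as ℚₚ
import Data.Rational.Unnormalised as ℚᵘ
import Data.Rational.Unnormalised.Properties as ℚᵘₚ
open import Data.Sum using (_⊎_; inj₁; inj₂)
import Data.Sum as Sum
open import Function using (_∘_; id; Injective)
open import Relation.Binary.PropositionalEquality
  using (_≡_; _≢_; refl; sym; trans; cong; cong₂; subst; subst₂; module ≡-Reasoning)
open import Relation.Nullary using (¬_; Dec; yes; no; does; ofʸ; ofⁿ)
open import Relation.Nullary.Decidable
  using (_×-dec_; _⊎-dec_; ¬?; decidable-stable; dec-true; dec-false; from-yes; from-no)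

-- Counting subsets of Fin n

true≢false : true ≢ false
true≢false ()

does-true : ∀ {A : Set} (a? : Dec A) → does a? ≡ true → A
does-true (yes a) _ = a

sumFin≡sum : ∀ {n} (f : Fin n → ℕ) → sumFin f ≡ sum f
sumFin≡sum {n} f = trans (cong List.sum (map-tabulate id f)) (tabulated n f)
  where
  tabulated : ∀ n (f : Fin n → ℕ) → List.sum (tabulate f) ≡ sum f
  tabulated zero    f = refl
  tabulated (suc n) f = cong (f fzero +_) (tabulated n (f ∘ fsuc))

sum-mono-≤ : ∀ {n} {f g : Fin n → ℕ} → (∀ i → f i ≤ g i) → sum f ≤ sum g
sum-mono-≤ {zero}  f≤g = z≤n
sum-mono-≤ {suc n} f≤g = +-mono-≤ (f≤g fzero) (sum-mono-≤ (f≤g ∘ fsuc))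

indicator : Bool → ℕ
indicator b = if b then 1 else 0

count : ∀ {n} → (Fin n → Bool) → ℕ
count P = sum (indicator ∘ P)

sum-if : ∀ {n} (P : Fin n → Bool) k → sum (λ i → if P i then k else 0) ≡ k * count P
sum-if P k = trans (sum-cong-≗ pointwise) (sym (*-distribˡ-sum k (indicator ∘ P)))
  where
  pointwise : ∀ i → (if P i then k else 0) ≡ k * indicator (P i)
  pointwise i with P i
  ... | true  = sym (*-identityʳ k)
  ... | false = sym (*-zeroʳ k)

_-_ : ∀ {n} → (Fin n → Bool) → Fin n → (Fin n → Bool)
(P - y) i = not (does (i ≟ y)) ∧ P i

module _ {n : ℕ} (P : Fin n → Bool) {y : Fin n} where

  -⊆ : ∀ {i} → (P - y) i ≡ true → P i ≡ true
  -⊆ = ∧-conicalʳ _ _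

  -self : (P - y) y ≡ false
  -self with y ≟ y
  ... | yes _  = refl
  ... | no y≢y = ⊥-elim (y≢y refl)

  -≢ : ∀ {i} → (P - y) i ≡ true → i ≢ y
  -≢ e refl = true≢false (trans (sym e) -self)

  -intro : ∀ {i} → P i ≡ true → i ≢ y → (P - y) i ≡ true
  -intro {i} Pi i≢y with i ≟ y
  ... | yes i≡y = ⊥-elim (i≢y i≡y)
  ... | no  _   = Pi

  -outside : ∀ {i} → P i ≡ false → (P - y) i ≡ false
  -outside {i} Pi rewrite Pi = ∧-zeroʳ _

  -removed : ∀ {i} → P i ≡ true → (P - y) i ≡ false → i ≡ y
  -removed {i} Pi e with i ≟ y
  ... | yes i≡y = i≡y
  ... | no  _   = ⊥-elim (true≢false (trans (sym Pi) e))

-removed₂ : ∀ {n} (P : Fin n → Bool) {y z i : Fin n} → P i ≡ true → ((P - y) - z) i ≡ false →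
            i ≡ y ⊎ i ≡ z
-removed₂ P {y} {z} {i} Pi out with (P - y) i Bool.≟ true
... | yes kept    = inj₂ (-removed (P - y) kept out)
... | no  removed = inj₁ (-removed P Pi (¬-not removed))

count-empty : ∀ {n} (P : Fin n → Bool) → (∀ i → P i ≡ false) → count P ≡ 0
count-empty {n} P P≡false =
  trans (sum-cong-≗ {n} {indicator ∘ P} {λ _ → 0} (cong indicator ∘ P≡false)) (sum-replicate-zero n)

-- The last clause relies on does (fsuc i ≟ fsuc y) reducing to does (i ≟ y), which ⌊_⌋ would not do.
count-singleton : ∀ {n} (y : Fin n) → count (λ i → does (i ≟ y)) ≡ 1
count-singleton {suc n} fzero    = cong suc (count-empty {n} (λ i → does (fsuc i ≟ fzero)) (λ _ → refl))
count-singleton         (fsuc y) = count-singleton y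

count-remove : ∀ {n} (P : Fin n → Bool) {y : Fin n} → P y ≡ true → count P ≡ suc (count (P - y))
count-remove P {y} Py = begin
  count P                                          ≡⟨ sum-cong-≗ {x = indicator ∘ P} split ⟩
  sum (λ i → indicator ((P - y) i) + singleton i)  ≡⟨ ∑-distrib-+ (indicator ∘ (P - y)) singleton ⟩
  count (P - y) + sum singleton                    ≡⟨ cong (count (P - y) +_) (count-singleton y) ⟩
  count (P - y) + 1                                ≡⟨ +-comm _ 1 ⟩
  suc (count (P - y))                              ∎
  where
  open ≡-Reasoning
  singleton : Fin _ → ℕ
  singleton i = indicator (does (i ≟ y))
  split : ∀ i → indicator (P i) ≡ indicator ((P - y) i) + singleton i
  split i with i ≟ y
  ... | yes refl rewrite Py = refl
  ... | no  _    = sym (+-identityʳ _)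

count-remove-< : ∀ {n} (P : Fin n → Bool) {y} → P y ≡ true → count (P - y) < count P
count-remove-< P Py = ≤-reflexive (sym (count-remove P Py))

count-∧ˡ : ∀ {n} b (P : Fin n → Bool) → count (λ i → b ∧ P i) ≡ (if b then count P else 0)
count-∧ˡ true  P = refl
count-∧ˡ false P = count-empty (λ i → false ∧ P i) (λ _ → refl)

count-∨ : ∀ {n} (P Q : Fin n → Bool) → (∀ i → P i ≡ true → Q i ≡ false) →
          count (λ i → P i ∨ Q i) ≡ count P + count Q
count-∨ P Q disjoint = trans (sum-cong-≗ pointwise) (∑-distrib-+ (indicator ∘ P) (indicator ∘ Q))
  where
  pointwise : ∀ i → indicator (P i ∨ Q i) ≡ indicator (P i) + indicator (Q i)
  pointwise i with P i in Pi
  ... | true  rewrite disjoint i Pi = refl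
  ... | false = refl

count-injective : ∀ {m n} {P : Fin m → Bool} {Q : Fin n → Bool} (g : Fin m → Fin n) →
                  Injective _≡_ _≡_ g → (∀ {i} → P i ≡ true → Q (g i) ≡ true) → count P ≤ count Q
count-injective {zero}  g inj maps = z≤n
count-injective {suc m} {P = P} {Q} g inj maps with P fzero in P0
... | false = count-injective (g ∘ fsuc) (Fin.suc-injective ∘ inj) maps
... | true  = begin
  suc (count (P ∘ fsuc))    ≤⟨ s≤s (count-injective (g ∘ fsuc) (Fin.suc-injective ∘ inj) maps′) ⟩
  suc (count (Q - g fzero)) ≡⟨ count-remove Q (maps P0) ⟨
  count Q                   ∎
  where
  open ≤-Reasoning
  maps′ : ∀ {i} → P (fsuc i) ≡ true → (Q - g fzero) (g (fsuc i)) ≡ true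
  maps′ Pi = -intro Q (maps Pi) (λ eq → Fin.0≢1+n (sym (inj eq)))

count-mono : ∀ {n} {P Q : Fin n → Bool} → (∀ {i} → P i ≡ true → Q i ≡ true) → count P ≤ count Q
count-mono = count-injective id id

count-injective-onto : ∀ {m n} {P : Fin m → Bool} {Q : Fin n → Bool} (g : Fin m → Fin n) →
                       Injective _≡_ _≡_ g → (∀ {i} → P i ≡ true → Q (g i) ≡ true) →
                       count Q ≤ count P → ∀ {z} → Q z ≡ true → ∃ λ i → P i ≡ true × g i ≡ z
count-injective-onto {P = P} {Q} g inj maps Q≤P {z} Qz with any? (λ i → (P i Bool.≟ true) ×-dec (g i ≟ z))
... | yes hit  = hit
... | no  miss = ⊥-elim (<-irrefl refl (begin-strict
  count P       ≤⟨ count-injective g inj (λ {i} Pi → -intro Q (maps Pi) (λ gi≡z → miss (i , Pi , gi≡z))) ⟩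
  count (Q - z) <⟨ count-remove-< Q Qz ⟩
  count Q       ≤⟨ Q≤P ⟩
  count P       ∎))
  where open ≤-Reasoning

count-positive : ∀ {n} {P : Fin n → Bool} → 0 < count P → ∃ λ i → P i ≡ true
count-positive {P = P} 0<count with any? (λ i → P i Bool.≟ true)
... | yes hit  = hit
... | no  none = ⊥-elim (<-irrefl (sym (count-empty P (λ i → ¬-not (λ Pi → none (i , Pi))))) 0<count)

-- Degrees and induced subgraphs

neighboursIn : (G : Graph) → (Fin (n G) → Bool) → Fin (n G) → Fin (n G) → Bool
neighboursIn G S i j = adj G i j ∧ S j

module _ (G : Graph) {S : Fin (n G) → Bool} {i j : Fin (n G)} where

  neighboursIn-intro : adj G i j ≡ true → S j ≡ true → neighboursIn G S i j ≡ true
  neighboursIn-intro ij Sj rewrite ij = Sj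

  neighboursIn-adj : neighboursIn G S i j ≡ true → adj G i j ≡ true
  neighboursIn-adj = ∧-conicalˡ _ _

  neighboursIn-∈ : neighboursIn G S i j ≡ true → S j ≡ true
  neighboursIn-∈ = ∧-conicalʳ _ _

degIn : (G : Graph) → (Fin (n G) → Bool) → Fin (n G) → ℕ
degIn G S i = count (neighboursIn G S i)

adj⇒≢ : (G : Graph) {i j : Fin (n G)} → adj G i j ≡ true → i ≢ j
adj⇒≢ G {i} ij refl = true≢false (trans (sym ij) (adj-irrefl G i))

minDeg≤deg : (G : Graph) (i : Fin (n G)) → minDeg G ≤ count (adj G i)
minDeg≤deg G i = subst (minDeg G ≤_) (sumFin≡sum (indicator ∘ adj G i)) (foldr-⊓≤ (deg G) (n G) (∈-allFin i))
  where
  foldr-⊓≤ : ∀ {A : Set} (f : A → ℕ) b {x} {xs : List A} → x ∈ xs → foldr (λ y m → f y ⊓ m) b xs ≤ f x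
  foldr-⊓≤ f b              (here refl)  = m⊓n≤m _ _
  foldr-⊓≤ f b {xs = y ∷ _} (there x∈xs) = ≤-trans (m⊓n≤n (f y) _) (foldr-⊓≤ f b x∈xs)

vertex-of-positive-minDeg : (G : Graph) → 1 ≤ minDeg G → Fin (n G)
vertex-of-positive-minDeg G = nonempty (n G) (deg G)
  where
  nonempty : ∀ m (f : Fin m → ℕ) → 1 ≤ foldr (λ i k → f i ⊓ k) m (allFin m) → Fin m
  nonempty (suc m) _ _ = fzero

induced : (G : Graph) → (Fin (n G) → Bool) → Subgraph G
induced G S = record
  { vs    = S
  ; es    = λ i j → S i ∧ neighboursIn G S i j
  ; es⊆   = λ i j e → neighboursIn-adj G {S} (∧-conicalʳ (S i) _ e)
  ; esSym = λ i j → trans (cong (λ a → S i ∧ (a ∧ S j)) (adj-sym G i j)) (swap (S i) (adj G j i) (S j))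
  ; esV   = λ i j e → ∧-conicalˡ (S i) _ e , neighboursIn-∈ G {S} (∧-conicalʳ (S i) _ e)
  }
  where
  swap : ∀ x a y → x ∧ (a ∧ y) ≡ y ∧ (a ∧ x)
  swap true  a true  = refl
  swap true  a false = ∧-zeroʳ a
  swap false a true  = sym (∧-zeroʳ a)
  swap false a false = refl

<ᵇ-either : ∀ {n} {i j : Fin n} → i ≢ j → indicator (toℕ i <ᵇ toℕ j) + indicator (toℕ j <ᵇ toℕ i) ≡ 1
<ᵇ-either {i = i} {j} i≢j
  with toℕ i <ᵇ toℕ j | <ᵇ-reflects-< (toℕ i) (toℕ j) | toℕ j <ᵇ toℕ i | <ᵇ-reflects-< (toℕ j) (toℕ i)
... | true  | ofʸ i<j | true  | ofʸ j<i = ⊥-elim (<-asym i<j j<i)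
... | true  | _       | false | _       = refl
... | false | _       | true  | _       = refl
... | false | ofⁿ i≮j | false | ofⁿ j≮i = ⊥-elim (i≢j (Fin.toℕ-injective (≤-antisym (≮⇒≥ j≮i) (≮⇒≥ i≮j))))

handshake : ∀ {n} (R : Fin n → Fin n → Bool) → (∀ i j → R i j ≡ R j i) → (∀ i → R i i ≡ false) →
            sum (λ i → count (R i)) ≡
            2 * sumFin (λ i → sumFin (λ j → if (toℕ i <ᵇ toℕ j) ∧ R i j then 1 else 0))
handshake {n} R R-sym R-irrefl = begin
  sum (λ i → count (R i))                    ≡⟨ sum-cong-≗ split ⟩
  sum (λ i → count (up i) + count (down i))  ≡⟨ ∑-distrib-+ (count ∘ up) (count ∘ down) ⟩
  X + sum (λ i → count (down i))             ≡⟨ cong (X +_) (∑-comm (λ i j → indicator (down i j))) ⟩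
  X + sum (λ j → sum (λ i → indicator (down i j)))  ≡⟨ cong (X +_) (sum-cong-≗ (sum-cong-≗ ∘ flip)) ⟩
  X + X                                      ≡⟨ cong (X +_) (+-identityʳ X) ⟨
  2 * X                                      ≡⟨ cong (2 *_) X≡ ⟩
  2 * sumFin (λ i → sumFin (λ j → indicator (up i j)))  ∎
  where
  open ≡-Reasoning
  up down : Fin n → Fin n → Bool
  up   i j = (toℕ i <ᵇ toℕ j) ∧ R i j
  down i j = (toℕ j <ᵇ toℕ i) ∧ R i j
  X : ℕ
  X = sum (λ i → count (up i))
  X≡ : X ≡ sumFin (λ i → sumFin (λ j → indicator (up i j)))
  X≡ = sym (trans (sumFin≡sum (λ i → sumFin (indicator ∘ up i)))
                  (sum-cong-≗ (λ i → sumFin≡sum (indicator ∘ up i))))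
  flip : ∀ j i → indicator (down i j) ≡ indicator (up j i)
  flip j i = cong (λ b → indicator ((toℕ j <ᵇ toℕ i) ∧ b)) (R-sym i j)
  split-pair : ∀ i j → indicator (R i j) ≡ indicator (up i j) + indicator (down i j)
  split-pair i j with R i j in Rij
  ... | true  rewrite ∧-identityʳ (toℕ i <ᵇ toℕ j) | ∧-identityʳ (toℕ j <ᵇ toℕ i) =
    sym (<ᵇ-either {i = i} {j} (λ { refl → true≢false (trans (sym Rij) (R-irrefl i)) }))
  ... | false rewrite ∧-zeroʳ (toℕ i <ᵇ toℕ j) | ∧-zeroʳ (toℕ j <ᵇ toℕ i) = refl
  split : ∀ i → count (R i) ≡ count (up i) + count (down i)
  split i = trans (sum-cong-≗ (split-pair i)) (∑-distrib-+ (indicator ∘ up i) (indicator ∘ down i))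

degree-sum-induced : (G : Graph) (S : Fin (n G) → Bool) →
                     sum (λ i → if S i then degIn G S i else 0) ≡ 2 * eS (induced G S)
degree-sum-induced G S =
  trans (sum-cong-≗ (λ i → sym (count-∧ˡ (S i) (neighboursIn G S i))))
        (handshake (es (induced G S)) (esSym (induced G S)) irrefl)
  where
  irrefl : ∀ i → S i ∧ (adj G i i ∧ S i) ≡ false
  irrefl i rewrite adj-irrefl G i = ∧-zeroʳ (S i)

-- The discharging bound

record Stuck (G : Graph) (δ : ℕ) (S : Fin (n G) → Bool) : Set where
  field
    no-low-vertex : ∀ {i} → S i ≡ true → δ ≤ degIn G S i
    no-tight-edge : ∀ {i j} → S i ≡ true → S j ≡ true → adj G i j ≡ true →
                    degIn G S i ≡ δ → degIn G S j ≢ δ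

discharging-arithmetic : ∀ δ v t e → suc δ * v ≤ 2 * e + t → 2 * (δ * t) ≤ 2 * e →
                         δ * suc δ * v ≤ suc (2 * δ) * e
discharging-arithmetic δ v t e v≤ t≤ = *-cancelˡ-≤ 2 (begin
  2 * (δ * suc δ * v)            ≡⟨ reassoc δ v ⟩
  2 * δ * (suc δ * v)            ≤⟨ *-monoʳ-≤ (2 * δ) v≤ ⟩
  2 * δ * (2 * e + t)            ≡⟨ expand δ e t ⟩
  2 * δ * (2 * e) + 2 * (δ * t)  ≤⟨ +-monoʳ-≤ (2 * δ * (2 * e)) t≤ ⟩
  2 * δ * (2 * e) + 2 * e        ≡⟨ collect δ e ⟩
  2 * (suc (2 * δ) * e)          ∎)
  where
  open ≤-Reasoning
  reassoc : ∀ δ v → 2 * (δ * suc δ * v) ≡ 2 * δ * (suc δ * v)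
  reassoc = solve-∀
  expand : ∀ δ e t → 2 * δ * (2 * e + t) ≡ 2 * δ * (2 * e) + 2 * (δ * t)
  expand = solve-∀
  collect : ∀ δ e → 2 * δ * (2 * e) + 2 * e ≡ 2 * (suc (2 * δ) * e)
  collect = solve-∀

-- With T the set of vertices of degree exactly δ, the degree sum 2e(S) is at least (δ+1)|S| − |T|, and
-- since T is independent, counting the edge ends in T gives 2δ|T| ≤ 2e(S).
module _ {G : Graph} {δ : ℕ} {S : Fin (n G) → Bool} (stuck : Stuck G δ S) where
  open Stuck stuck

  private
    d : Fin (n G) → ℕ
    d = degIn G S

    E : Fin (n G) → Fin (n G) → Bool
    E = es (induced G S)

    tight : Fin (n G) → Bool
    tight i = S i ∧ does (d i ℕ.≟ δ)

    d-in-S : Fin (n G) → ℕ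
    d-in-S i = if S i then d i else 0

    D : ℕ
    D = sum d-in-S

    row : ∀ i → count (E i) ≡ d-in-S i
    row i = count-∧ˡ (S i) (neighboursIn G S i)

    tight-degree : ∀ {i} → tight i ≡ true → d i ≡ δ
    tight-degree {i} ti = does-true (d i ℕ.≟ δ) (∧-conicalʳ (S i) _ ti)

    tight-row : ∀ {i} → tight i ≡ true → count (E i) ≡ δ
    tight-row {i} ti rewrite row i | ∧-conicalˡ (S i) _ ti = tight-degree ti

    vertices≤ : suc δ * count S ≤ D + count tight
    vertices≤ = begin
      suc δ * count S                                ≡⟨ sum-if S (suc δ) ⟨
      sum (λ i → if S i then suc δ else 0)           ≤⟨ sum-mono-≤ pointwise ⟩
      sum (λ i → d-in-S i + indicator (tight i))     ≡⟨ ∑-distrib-+ d-in-S (indicator ∘ tight) ⟩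
      D + count tight                                ∎
      where
      open ≤-Reasoning
      pointwise : ∀ i → (if S i then suc δ else 0) ≤ d-in-S i + indicator (S i ∧ does (d i ℕ.≟ δ))
      pointwise i with S i in Si
      ... | false = z≤n
      ... | true  = by-cases (d i ℕ.≟ δ)
        where
        by-cases : (d≟δ : Dec (d i ≡ δ)) → suc δ ≤ d i + indicator (does d≟δ)
        by-cases (yes d≡δ) = ≤-reflexive (trans (cong suc (sym d≡δ)) (+-comm 1 (d i)))
        by-cases (no  d≢δ) = ≤-trans (≤∧≢⇒< (no-low-vertex Si) (d≢δ ∘ sym)) (m≤m+n (d i) 0)

    tight-ends : ℕ
    tight-ends = sum (λ i → count (λ j → tight i ∧ E i j))

    tight-ends≡ : δ * count tight ≡ tight-ends
    tight-ends≡ = trans (sym (sum-if tight δ)) (sum-cong-≗ pointwise)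
      where
      pointwise : ∀ i → (if tight i then δ else 0) ≡ count (λ j → tight i ∧ E i j)
      pointwise i with tight i in ti
      ... | true  = sym (tight-row ti)
      ... | false = sym (count-empty (λ j → false ∧ E i j) (λ _ → refl))

    tight-ends-flip : tight-ends ≡ sum (λ i → count (λ j → tight j ∧ E i j))
    tight-ends-flip = trans (∑-comm (λ i j → indicator (tight i ∧ E i j)))
                            (sum-cong-≗ (sum-cong-≗ ∘ flip))
      where
      flip : ∀ i j → indicator (tight j ∧ E j i) ≡ indicator (tight j ∧ E i j)
      flip i j = cong (λ b → indicator (tight j ∧ b)) (esSym (induced G S) j i)

    one-tight-end : ∀ i j → indicator (tight i ∧ E i j) + indicator (tight j ∧ E i j) ≤ indicator (E i j)
    one-tight-end i j with E i j in Eij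
    ... | false rewrite ∧-zeroʳ (tight i) | ∧-zeroʳ (tight j) = z≤n
    ... | true  rewrite ∧-identityʳ (tight i) | ∧-identityʳ (tight j) with tight i in ti | tight j in tj
    ...   | false | false = z≤n
    ...   | false | true  = ≤-refl
    ...   | true  | false = ≤-refl
    ...   | true  | true  = ⊥-elim (no-tight-edge Si Sj (es⊆ (induced G S) i j Eij)
                                                  (tight-degree ti) (tight-degree tj))
      where
      Si : S i ≡ true
      Si = proj₁ (esV (induced G S) i j Eij)
      Sj : S j ≡ true
      Sj = proj₂ (esV (induced G S) i j Eij)

    tight≤ : 2 * (δ * count tight) ≤ D
    tight≤ = begin
      2 * (δ * count tight)                                          ≡⟨ cong (2 *_) tight-ends≡ ⟩
      2 * tight-ends                                                 ≡⟨ cong (tight-ends +_) (+-identityʳ _) ⟩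
      tight-ends + tight-ends                                        ≡⟨ cong (tight-ends +_) tight-ends-flip ⟩
      tight-ends + sum (λ i → count (λ j → tight j ∧ E i j))         ≡⟨ ∑-distrib-+ tail-tight head-tight ⟨
      sum (λ i → tail-tight i + head-tight i)                        ≤⟨ sum-mono-≤ row-ends ⟩
      sum (λ i → count (E i))                                        ≡⟨ sum-cong-≗ row ⟩
      D                                                              ∎
      where
      open ≤-Reasoning
      tail-tight head-tight : Fin (n G) → ℕ
      tail-tight i = count (λ j → tight i ∧ E i j)
      head-tight i = count (λ j → tight j ∧ E i j)
      row-ends : ∀ i → tail-tight i + head-tight i ≤ count (E i)
      row-ends i = ≤-trans (≤-reflexive (sym (∑-distrib-+ (λ j → indicator (tight i ∧ E i j))
                                                            (λ j → indicator (tight j ∧ E i j)))))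
                           (sum-mono-≤ (one-tight-end i))

  Stuck⇒dense : δ * suc δ * count S ≤ suc (2 * δ) * eS (induced G S)
  Stuck⇒dense = discharging-arithmetic δ (count S) (count tight) (eS (induced G S))
                  (subst (λ x → suc δ * count S ≤ x + count tight) D≡2e vertices≤)
                  (subst (2 * (δ * count tight) ≤_) D≡2e tight≤)
    where
    D≡2e : D ≡ 2 * eS (induced G S)
    D≡2e = degree-sum-induced G S

-- Triangles and the rational bounds

TriangleFree : Graph → Set
TriangleFree G = ∀ {a b c} → adj G a b ≡ true → adj G b c ≡ true → adj G a c ≡ true → ⊥

clique-edges : (G : Graph) (K : Fin (n G) → Bool) →
               (∀ {i j} → K i ≡ true → K j ≡ true → i ≢ j → adj G i j ≡ true) →
               2 * eS (induced G K) ≡ pred (count K) * count K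
clique-edges G K clique = begin
  2 * eS (induced G K)                           ≡⟨ degree-sum-induced G K ⟨
  sum (λ i → if K i then degIn G K i else 0)     ≡⟨ sum-cong-≗ degree ⟩
  sum (λ i → if K i then pred (count K) else 0)  ≡⟨ sum-if K (pred (count K)) ⟩
  pred (count K) * count K                       ∎
  where
  open ≡-Reasoning
  others : ∀ {i} → K i ≡ true → ∀ j → neighboursIn G K i j ≡ (K - i) j
  others {i} Ki j with j ≟ i | K j in Kj
  ... | yes refl | _     rewrite adj-irrefl G i = refl
  ... | no  _    | false = ∧-zeroʳ (adj G i j)
  ... | no  j≢i  | true  rewrite clique Ki Kj (j≢i ∘ sym) = refl
  degree : ∀ i → (if K i then degIn G K i else 0) ≡ (if K i then pred (count K) else 0)
  degree i with K i in Ki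
  ... | true  = trans (sum-cong-≗ (cong indicator ∘ others Ki)) (cong pred (sym (count-remove K Ki)))
  ... | false = refl

triangle-subgraph : (G : Graph) {a b c : Fin (n G)} →
                    adj G a b ≡ true → adj G b c ≡ true → adj G a c ≡ true →
                    ∃ λ (J : Subgraph G) → vS J ≡ 3 × eS J ≡ 3
triangle-subgraph G {a} {b} {c} ab bc ac =
  induced G T , trans (sumFin≡sum (indicator ∘ T)) count≡3 ,
  *-cancelˡ-≡ _ 3 2 (trans (clique-edges G T edge) (cong (λ k → pred k * k) count≡3))
  where
  T : Fin (n G) → Bool
  T z = does (z ≟ a) ∨ (does (z ≟ b) ∨ does (z ≟ c))

  count≡3 : count T ≡ 3
  count≡3 = trans (count-∨ (λ z → does (z ≟ a)) (λ z → does (z ≟ b) ∨ does (z ≟ c)) a-only)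
                  (cong₂ _+_ (count-singleton a)
                             (trans (count-∨ (λ z → does (z ≟ b)) (λ z → does (z ≟ c)) b-only)
                                    (cong₂ _+_ (count-singleton b) (count-singleton c))))
    where
    a-only : ∀ z → does (z ≟ a) ≡ true → (does (z ≟ b) ∨ does (z ≟ c)) ≡ false
    a-only z e with refl ← does-true (z ≟ a) e
      rewrite dec-false (z ≟ b) (adj⇒≢ G ab) | dec-false (z ≟ c) (adj⇒≢ G ac) = refl
    b-only : ∀ z → does (z ≟ b) ≡ true → does (z ≟ c) ≡ false
    b-only z e with refl ← does-true (z ≟ b) e = dec-false (z ≟ c) (adj⇒≢ G bc)

  member : ∀ {z} → T z ≡ true → z ≡ a ⊎ z ≡ b ⊎ z ≡ c
  member {z} e with z ≟ a | z ≟ b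
  ... | yes z≡a | _       = inj₁ z≡a
  ... | no  _   | yes z≡b = inj₂ (inj₁ z≡b)
  ... | no  _   | no  _   = inj₂ (inj₂ (does-true (z ≟ c) e))

  edge : ∀ {i j} → T i ≡ true → T j ≡ true → i ≢ j → adj G i j ≡ true
  edge {i} {j} Ti Tj i≢j with member {i} Ti | member {j} Tj
  ... | inj₁ refl        | inj₁ refl        = ⊥-elim (i≢j refl)
  ... | inj₁ refl        | inj₂ (inj₁ refl) = ab
  ... | inj₁ refl        | inj₂ (inj₂ refl) = ac
  ... | inj₂ (inj₁ refl) | inj₁ refl        = trans (adj-sym G b a) ab
  ... | inj₂ (inj₁ refl) | inj₂ (inj₁ refl) = ⊥-elim (i≢j refl)
  ... | inj₂ (inj₁ refl) | inj₂ (inj₂ refl) = bc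
  ... | inj₂ (inj₂ refl) | inj₁ refl        = trans (adj-sym G c a) ac
  ... | inj₂ (inj₂ refl) | inj₂ (inj₁ refl) = trans (adj-sym G c b) bc
  ... | inj₂ (inj₂ refl) | inj₂ (inj₂ refl) = ⊥-elim (i≢j refl)

/<⇒*< : ∀ a b c d → (ℤ.+ a / suc b) ℚ.< (ℤ.+ c / suc d) → a * suc d < c * suc b
/<⇒*< a b c d a/b<c/d =
  drop‿+<+ (subst₂ ℤ._<_ (sym (pos-* a (suc d))) (sym (pos-* c (suc b))) (ℚᵘₚ.drop-*<* unnormalised))
  where
  unnormalised : ℚᵘ.mkℚᵘ (ℤ.+ a) b ℚᵘ.< ℚᵘ.mkℚᵘ (ℤ.+ c) d
  unnormalised = ℚᵘₚ.<-respʳ-≃ (ℚₚ.toℚᵘ-fromℚᵘ (ℚᵘ.mkℚᵘ (ℤ.+ c) d))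
                   (ℚᵘₚ.<-respˡ-≃ (ℚₚ.toℚᵘ-fromℚᵘ (ℚᵘ.mkℚᵘ (ℤ.+ a) b)) (ℚₚ.toℚᵘ-mono-< a/b<c/d))

density<bound⇒*< : ∀ {q} d v e → 1 ≤ v → density v e ℚ.≤ q → q ℚ.< bound d →
                   suc (2 * d) * e < d * suc d * v
density<bound⇒*< {q} d (suc k) e _ e/v≤q q<bound =
  subst (_< d * suc d * suc k) (*-comm e (suc (2 * d)))
        (/<⇒*< e k (d * suc d) (2 * d) (ℚₚ.≤-<-trans e/v≤q q<bound))

1<bound⇒2≤ : ∀ d → 1ℚ ℚ.< bound d → 2 ≤ d
1<bound⇒2≤ 0             1<bound = ⊥-elim (from-no (1ℚ ℚ.<? bound 0) 1<bound)
1<bound⇒2≤ 1             1<bound = ⊥-elim (from-no (1ℚ ℚ.<? bound 1) 1<bound)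
1<bound⇒2≤ (suc (suc d)) _       = s≤s (s≤s z≤n)

m₂<bound₂⇒triangle-free : ∀ {H q} → IsM2 H q → q ℚ.< bound 2 → TriangleFree H
m₂<bound₂⇒triangle-free {H} {q} (_ , maximal) q<bound ab bc ac with triangle-subgraph H ab bc ac
... | J , v≡3 , e≡3 =
  ℚₚ.<-irrefl refl (ℚₚ.<-trans (ℚₚ.≤-<-trans d₂≤q q<bound) (from-yes (bound 2 ℚ.<? d₂ 3 3)))
  where
  d₂≤q : d₂ 3 3 ℚ.≤ q
  d₂≤q = subst₂ (λ v e → d₂ v e ℚ.≤ q) v≡3 e≡3 (maximal J)

-- Edge colourings

SameEdge : ∀ {A : Set} → A → A → A → A → Set
SameEdge a b a′ b′ = (a ≡ a′ × b ≡ b′) ⊎ (a ≡ b′ × b ≡ a′)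

SameEdge-flip : ∀ {A : Set} {a b a′ b′ : A} → SameEdge a b a′ b′ → SameEdge b a a′ b′
SameEdge-flip (inj₁ (a≡a′ , b≡b′)) = inj₂ (b≡b′ , a≡a′)
SameEdge-flip (inj₂ (a≡b′ , b≡a′)) = inj₁ (b≡a′ , a≡b′)

sameEdge? : ∀ {N} (a b a′ b′ : Fin N) → Dec (SameEdge a b a′ b′)
sameEdge? a b a′ b′ = ((a ≟ a′) ×-dec (b ≟ b′)) ⊎-dec ((a ≟ b′) ×-dec (b ≟ a′))

module _ (G : Graph) where

  private
    pairCode : Fin (n G) → Fin (n G) → ℕ
    pairCode a b = toℕ (combine a b)

    pairCode-injective : ∀ {a b a′ b′} → pairCode a b ≡ pairCode a′ b′ → a ≡ a′ × b ≡ b′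
    pairCode-injective {a} {b} {a′} {b′} e = Fin.combine-injective a b a′ b′ (Fin.toℕ-injective e)

  -- The smaller of the codes of (a, b) and (b, a): symmetric, and it determines the pair {a, b}.
  edgeCode : Colouring G
  edgeCode a b = pairCode a b ⊓ pairCode b a

  edgeCode-injective : ∀ {a b a′ b′} → edgeCode a b ≡ edgeCode a′ b′ → SameEdge a b a′ b′
  edgeCode-injective {a} {b} {a′} {b′} eq =
    by-cases (⊓-sel (pairCode a b) (pairCode b a)) (⊓-sel (pairCode a′ b′) (pairCode b′ a′))
    where
    decode : ∀ {p q r s} → edgeCode a b ≡ pairCode p q → edgeCode a′ b′ ≡ pairCode r s → p ≡ r × q ≡ s
    decode e e′ = pairCode-injective (trans (sym e) (trans eq e′))
    swap : ∀ {A B : Set} → A × B → B × A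
    swap (x , y) = y , x
    by-cases : edgeCode a b ≡ pairCode a b ⊎ edgeCode a b ≡ pairCode b a →
               edgeCode a′ b′ ≡ pairCode a′ b′ ⊎ edgeCode a′ b′ ≡ pairCode b′ a′ →
               SameEdge a b a′ b′
    by-cases (inj₁ e) (inj₁ e′) = inj₁ (decode e e′)
    by-cases (inj₁ e) (inj₂ e′) = inj₂ (decode e e′)
    by-cases (inj₂ e) (inj₁ e′) = inj₂ (swap (decode e e′))
    by-cases (inj₂ e) (inj₂ e′) = inj₁ (swap (decode e e′))

  edgeCode-proper : ProperColouring G edgeCode
  edgeCode-proper = (λ a b _ → ⊓-comm (pairCode a b) _) , distinct
    where
    distinct : ∀ a b b′ → adj G a b ≡ true → adj G a b′ ≡ true → b ≢ b′ → edgeCode a b ≢ edgeCode a b′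
    distinct a b b′ _ _ b≢b′ eq with edgeCode-injective eq
    ... | inj₁ (_ , b≡b′)    = b≢b′ b≡b′
    ... | inj₂ (refl , refl) = b≢b′ refl

  recolour : Colouring G → Fin (n G) → Fin (n G) → ℕ → Colouring G
  recolour c v y k a b = if does (sameEdge? a b v y) then k else c a b

  module _ {c : Colouring G} {v y : Fin (n G)} {k : ℕ} where

    recolour-on : ∀ {a b} → SameEdge a b v y → recolour c v y k a b ≡ k
    recolour-on {a} {b} e = cong (λ t → if t then k else c a b) (dec-true (sameEdge? a b v y) e)

    recolour-off : ∀ {a b} → ¬ SameEdge a b v y → recolour c v y k a b ≡ c a b
    recolour-off {a} {b} ¬e = cong (λ t → if t then k else c a b) (dec-false (sameEdge? a b v y) ¬e)

    recolour-proper : ProperColouring G c → v ≢ y →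
                      (∀ {a b} → adj G a b ≡ true → c a b ≡ k → a ≢ v × a ≢ y) →
                      ProperColouring G (recolour c v y k)
    recolour-proper (c-sym , c-distinct) v≢y k-absent = c′-sym , c′-distinct
      where
      c′ : Colouring G
      c′ = recolour c v y k
      at-endpoint : ∀ {a b b′} → adj G a b ≡ true → c a b ≡ k → ¬ SameEdge a b′ v y
      at-endpoint ab ck (inj₁ (a≡v , _)) = proj₁ (k-absent ab ck) a≡v
      at-endpoint ab ck (inj₂ (a≡y , _)) = proj₂ (k-absent ab ck) a≡y
      c′-sym : ∀ a b → adj G a b ≡ true → c′ a b ≡ c′ b a
      c′-sym a b ab with sameEdge? a b v y
      ... | yes e = trans (recolour-on e) (sym (recolour-on (SameEdge-flip e)))
      ... | no ¬e = trans (recolour-off ¬e) (trans (c-sym a b ab) (sym (recolour-off (¬e ∘ SameEdge-flip))))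
      c′-distinct : ∀ a b b′ → adj G a b ≡ true → adj G a b′ ≡ true → b ≢ b′ → c′ a b ≢ c′ a b′
      c′-distinct a b b′ ab ab′ b≢b′ eq with sameEdge? a b v y | sameEdge? a b′ v y
      ... | yes (inj₁ (_ , b≡y)) | yes (inj₁ (_ , b′≡y)) = b≢b′ (trans b≡y (sym b′≡y))
      ... | yes (inj₂ (_ , b≡v)) | yes (inj₂ (_ , b′≡v)) = b≢b′ (trans b≡v (sym b′≡v))
      ... | yes (inj₁ (a≡v , _)) | yes (inj₂ (a≡y , _)) = v≢y (trans (sym a≡v) a≡y)
      ... | yes (inj₂ (a≡y , _)) | yes (inj₁ (a≡v , _)) = v≢y (trans (sym a≡v) a≡y)
      ... | yes e  | no  ¬e′ =
        at-endpoint ab′ (trans (sym (recolour-off ¬e′)) (trans (sym eq) (recolour-on e))) e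
      ... | no  ¬e | yes e′  =
        at-endpoint ab (trans (sym (recolour-off ¬e)) (trans eq (recolour-on e′))) e′
      ... | no  ¬e | no  ¬e′ =
        c-distinct a b b′ ab ab′ b≢b′ (trans (sym (recolour-off ¬e)) (trans eq (recolour-off ¬e′)))

-- Copies of H

module _ (H B : Graph) where

  IsCopy : (Fin (n H) → Fin (n B)) → Set
  IsCopy φ = (∀ i j → φ i ≡ φ j → i ≡ j) × (∀ i j → adj H i j ≡ true → adj B (φ i) (φ j) ≡ true)

  module _ {S : Fin (n B) → Bool} {φ : Fin (n H) → Fin (n B)}
           (copy : IsCopy φ) (inside : ∀ i → S (φ i) ≡ true) where

    private
      maps : ∀ {i k} → adj H i k ≡ true → neighboursIn B S (φ i) (φ k) ≡ true
      maps {i} {k} ik = neighboursIn-intro B {S} (proj₂ copy i k ik) (inside k)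

      injective : Injective _≡_ _≡_ φ
      injective {i} {j} = proj₁ copy i j

    deg≤degIn : ∀ i → count (adj H i) ≤ degIn B S (φ i)
    deg≤degIn i = count-injective φ injective maps

    neighbour-in-copy : ∀ {i} → degIn B S (φ i) ≤ count (adj H i) →
                        ∀ {z} → neighboursIn B S (φ i) z ≡ true → ∃ λ k → adj H i k ≡ true × φ k ≡ z
    neighbour-in-copy = count-injective-onto φ injective maps

-- Peeling

module Peeling (H B : Graph) where

  δ : ℕ
  δ = minDeg H

  Leaves : (Fin (n B) → Bool) → Fin (n B) → Fin (n B) → Set
  Leaves S a b = S a ≡ false ⊎ S b ≡ false

  record Clash (S : Fin (n B) → Bool) (c : Colouring B) (φ : Fin (n H) → Fin (n B)) : Set where
    field
      i j k l     : Fin (n H)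
      ij          : adj H i j ≡ true
      kl          : adj H k l ≡ true
      different   : ¬ SameEdge i j k l
      same-colour : c (φ i) (φ j) ≡ c (φ k) (φ l)
      ij-leaves   : Leaves S (φ i) (φ j)
      kl-leaves   : Leaves S (φ k) (φ l)

  UniqueInside : (Fin (n B) → Bool) → Colouring B → Set
  UniqueInside S c = ∀ {a b f g} → S a ≡ true → S b ≡ true → adj B a b ≡ true →
                     adj B f g ≡ true → c f g ≡ c a b → SameEdge f g a b

  record Invariant (S : Fin (n B) → Bool) (c : Colouring B) : Set where
    field
      proper        : ProperColouring B c
      unique-inside : UniqueInside S c
      clash-outside : ∀ {φ} → IsCopy H B φ → (∃ λ i → S (φ i) ≡ false) → Clash S c φ
  open Invariant

  Progress : (Fin (n B) → Bool) → Set
  Progress S = ∃₂ λ S′ c′ → Invariant S′ c′ × count S′ < count S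

  EnteringClash : (Fin (n B) → Bool) → (Fin (n B) → Bool) → Colouring B → Set
  EnteringClash S S′ c′ = ∀ {φ} → IsCopy H B φ → (∀ i → S (φ i) ≡ true) → ∀ {i} → S′ (φ i) ≡ false →
                          Clash S′ c′ φ

  initial : Invariant (λ _ → true) (edgeCode B)
  initial = record
    { proper        = edgeCode-proper B
    ; unique-inside = λ _ _ _ _ → edgeCode-injective B
    ; clash-outside = λ _ → nothing-outside
    }
    where
    nothing-outside : ∀ {φ : Fin (n H) → Fin (n B)} → (∃ λ i → true ≡ false) →
                      Clash (λ _ → true) (edgeCode B) φ
    nothing-outside (_ , ())

  clash-mono : ∀ {S S′ c c′ φ} → (∀ {a} → S′ a ≡ true → S a ≡ true) →
               (∀ {a b} → Leaves S a b → c′ a b ≡ c a b) → Clash S c φ → Clash S′ c′ φ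
  clash-mono {S} {S′} S′⊆S agree clash = record
    { i = i ; j = j ; k = k ; l = l ; ij = ij ; kl = kl ; different = different
    ; same-colour = trans (agree ij-leaves) (trans same-colour (sym (agree kl-leaves)))
    ; ij-leaves   = Sum.map outside outside ij-leaves
    ; kl-leaves   = Sum.map outside outside kl-leaves
    }
    where
    open Clash clash
    outside : ∀ {a} → S a ≡ false → S′ a ≡ false
    outside Sa = ¬-not (λ S′a → true≢false (trans (sym (S′⊆S S′a)) Sa))

  shrink : ∀ {S S′ c c′} → Invariant S c → (∀ {a} → S′ a ≡ true → S a ≡ true) →
           (∀ {a b} → Leaves S a b → c′ a b ≡ c a b) → ProperColouring B c′ → UniqueInside S′ c′ →
           EnteringClash S S′ c′ → Invariant S′ c′
  shrink {S} {S′} {c} {c′} inv S′⊆S agree proper′ unique′ entering = record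
    { proper = proper′ ; unique-inside = unique′ ; clash-outside = outside }
    where
    outside : ∀ {φ} → IsCopy H B φ → (∃ λ i → S′ (φ i) ≡ false) → Clash S′ c′ φ
    outside {φ} copy (i , S′φi) with any? (λ i → S (φ i) Bool.≟ false)
    ... | yes left  = clash-mono S′⊆S agree (clash-outside inv copy left)
    ... | no  stays = entering copy (λ i → ¬-not (λ Sφi → stays (i , Sφi))) S′φi

  restrict : ∀ {S S′ c} → Invariant S c → (∀ {a} → S′ a ≡ true → S a ≡ true) → EnteringClash S S′ c →
             Invariant S′ c
  restrict inv S′⊆S = shrink inv S′⊆S (λ _ → refl) (proper inv)
                        (λ S′a S′b → unique-inside inv (S′⊆S S′a) (S′⊆S S′b))

  remove-low : ∀ {S c w} → Invariant S c → S w ≡ true → degIn B S w < δ → Invariant (S - w) c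
  remove-low {S} {c} {w} inv Sw low = restrict inv (-⊆ S) entering
    where
    entering : EnteringClash S (S - w) c
    entering copy inside {i} out with refl ← -removed S (inside i) out =
      ⊥-elim (<-irrefl refl (≤-<-trans (≤-trans (minDeg≤deg H i) (deg≤degIn H B copy inside i)) low))

  record TightEdge (S : Fin (n B) → Bool) : Set where
    field
      u v   : Fin (n B)
      u∈S   : S u ≡ true
      v∈S   : S v ≡ true
      uv    : adj B u v ≡ true
      deg-u : degIn B S u ≡ δ
      deg-v : degIn B S v ≡ δ

  module Tight {S : Fin (n B) → Bool} {c : Colouring B} (inv : Invariant S c) (t : TightEdge S) where
    open TightEdge t

    vu : adj B v u ≡ true
    vu = trans (adj-sym B v u) uv

    u≢v : u ≢ v
    u≢v = adj⇒≢ B uv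

    Fork : Fin (n B) → Fin (n B) → Set
    Fork x y = (neighboursIn B S u - v) x ≡ true × (neighboursIn B S v - u) y ≡ true × x ≢ y

    fork-end : ∀ w w′ {z} → (neighboursIn B S w - w′) z ≡ true → adj B w z ≡ true × S z ≡ true × z ≢ w′
    fork-end w w′ {z} e = neighboursIn-adj B {S} wz , neighboursIn-∈ B {S} wz , -≢ (neighboursIn B S w) {w′} e
      where
      wz : neighboursIn B S w z ≡ true
      wz = -⊆ (neighboursIn B S w) {w′} e

    fork? : ∀ x y → Dec (Fork x y)
    fork? x y = ((neighboursIn B S u - v) x Bool.≟ true) ×-dec ((neighboursIn B S v - u) y Bool.≟ true)
                  ×-dec ¬? (x ≟ y)

    δ-neighbour-in-copy : ∀ {φ} → IsCopy H B φ → (∀ i → S (φ i) ≡ true) → ∀ {w} → degIn B S w ≡ δ →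
                          ∀ {i} → φ i ≡ w → ∀ {z} → adj B w z ≡ true → S z ≡ true →
                          ∃ λ k → adj H i k ≡ true × φ k ≡ z
    δ-neighbour-in-copy copy inside deg {i} refl wz Sz =
      neighbour-in-copy H B copy inside (subst (_≤ count (adj H i)) (sym deg) (minDeg≤deg H i))
                        (neighboursIn-intro B {S} wz Sz)

    module Recolour {x y : Fin (n B)} (fork : Fork x y) where
      private
        ux : adj B u x ≡ true
        ux = proj₁ (fork-end u v (proj₁ fork))
        x∈S : S x ≡ true
        x∈S = proj₁ (proj₂ (fork-end u v (proj₁ fork)))
        x≢v : x ≢ v
        x≢v = proj₂ (proj₂ (fork-end u v (proj₁ fork)))
        vy : adj B v y ≡ true
        vy = proj₁ (fork-end v u (proj₁ (proj₂ fork)))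
        y∈S : S y ≡ true
        y∈S = proj₁ (proj₂ (fork-end v u (proj₁ (proj₂ fork))))
        y≢u : y ≢ u
        y≢u = proj₂ (proj₂ (fork-end v u (proj₁ (proj₂ fork))))
        x≢y : x ≢ y
        x≢y = proj₂ (proj₂ fork)

      S′ : Fin (n B) → Bool
      S′ = (S - u) - v

      c′ : Colouring B
      c′ = recolour B c v y (c u x)

      S′⊆S : ∀ {a} → S′ a ≡ true → S a ≡ true
      S′⊆S = -⊆ S ∘ -⊆ (S - u)

      u∉S′ : S′ u ≡ false
      u∉S′ = -outside (S - u) {v} {u} (-self S)

      v∉S′ : S′ v ≡ false
      v∉S′ = -self (S - u) {v}

      c′-on : ∀ {a b} → SameEdge a b v y → c′ a b ≡ c u x
      c′-on = recolour-on B {c} {v} {y} {c u x}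

      c′-off : ∀ {a b} → ¬ SameEdge a b v y → c′ a b ≡ c a b
      c′-off = recolour-off B {c} {v} {y} {c u x}

      c′-ux : c′ u x ≡ c u x
      c′-ux = c′-off λ { (inj₁ (u≡v , _)) → u≢v u≡v ; (inj₂ (u≡y , _)) → y≢u (sym u≡y) }

      c′-inside : ∀ {a b} → S′ a ≡ true → S′ b ≡ true → c′ a b ≡ c a b
      c′-inside S′a S′b = c′-off λ where
        (inj₁ (refl , _)) → true≢false (trans (sym S′a) v∉S′)
        (inj₂ (_ , refl)) → true≢false (trans (sym S′b) v∉S′)

      agree : ∀ {a b} → Leaves S a b → c′ a b ≡ c a b
      agree {a} {b} leaves = c′-off (λ e → inside e leaves)
        where
        inside : SameEdge a b v y → ¬ Leaves S a b
        inside (inj₁ (refl , refl)) (inj₁ out) = true≢false (trans (sym v∈S) out)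
        inside (inj₁ (refl , refl)) (inj₂ out) = true≢false (trans (sym y∈S) out)
        inside (inj₂ (refl , refl)) (inj₁ out) = true≢false (trans (sym y∈S) out)
        inside (inj₂ (refl , refl)) (inj₂ out) = true≢false (trans (sym v∈S) out)

      proper′ : ProperColouring B c′
      proper′ = recolour-proper B (proper inv) (adj⇒≢ B vy) absent
        where
        absent : ∀ {a b} → adj B a b ≡ true → c a b ≡ c u x → a ≢ v × a ≢ y
        absent ab eq with unique-inside inv u∈S x∈S ux ab eq
        ... | inj₁ (refl , _) = u≢v , y≢u ∘ sym
        ... | inj₂ (refl , _) = x≢v , x≢y

      unique′ : UniqueInside S′ c′
      unique′ {a} {b} {f} {g} S′a S′b ab fg eq with sameEdge? f g v y
      ... | yes e  = ⊥-elim (u∉ab (unique-inside inv (S′⊆S S′a) (S′⊆S S′b) ab ux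
                                     (trans (sym (c′-on e)) (trans eq (c′-inside S′a S′b)))))
        where
        u∉ab : ¬ SameEdge u x a b
        u∉ab (inj₁ (refl , _)) = true≢false (trans (sym S′a) u∉S′)
        u∉ab (inj₂ (refl , _)) = true≢false (trans (sym S′b) u∉S′)
      ... | no  ¬e = unique-inside inv (S′⊆S S′a) (S′⊆S S′b) ab fg
                       (trans (sym (c′-off ¬e)) (trans eq (c′-inside S′a S′b)))

      entering : EnteringClash S S′ c′
      entering {φ} copy inside {i} out = clash-through-u (hits-u (-removed₂ S (inside i) out))
        where
        hits-u : φ i ≡ u ⊎ φ i ≡ v → ∃ λ i₀ → φ i₀ ≡ u
        hits-u (inj₁ φi≡u) = i , φi≡u
        hits-u (inj₂ φi≡v) with δ-neighbour-in-copy copy inside deg-v φi≡v vu u∈S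
        ... | k , _ , φk≡u = k , φk≡u
        clash-through-u : (∃ λ i₀ → φ i₀ ≡ u) → Clash S′ c′ φ
        clash-through-u (i₀ , φi₀≡u)
          with δ-neighbour-in-copy copy inside deg-u φi₀≡u ux x∈S
             | δ-neighbour-in-copy copy inside deg-u φi₀≡u uv v∈S
        ... | k , i₀k , φk≡x | j , _ , φj≡v with δ-neighbour-in-copy copy inside deg-v φj≡v vy y∈S
        ... | l , jl , φl≡y = record
          { i = i₀ ; j = k ; k = j ; l = l ; ij = i₀k ; kl = jl
          ; different   = different
          ; same-colour = begin
              c′ (φ i₀) (φ k) ≡⟨ cong₂ c′ φi₀≡u φk≡x ⟩
              c′ u x          ≡⟨ c′-ux ⟩
              c u x           ≡⟨ c′-on (inj₁ (refl , refl)) ⟨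
              c′ v y          ≡⟨ cong₂ c′ φj≡v φl≡y ⟨
              c′ (φ j) (φ l)  ∎
          ; ij-leaves   = inj₁ (trans (cong S′ φi₀≡u) u∉S′)
          ; kl-leaves   = inj₁ (trans (cong S′ φj≡v) v∉S′)
          }
          where
          open ≡-Reasoning
          different : ¬ SameEdge i₀ k j l
          different (inj₁ (i₀≡j , _)) = u≢v (trans (sym φi₀≡u) (trans (cong φ i₀≡j) φj≡v))
          different (inj₂ (i₀≡l , _)) = y≢u (trans (sym φl≡y) (trans (cong φ (sym i₀≡l)) φi₀≡u))

      progress : Progress S
      progress = S′ , c′ , shrink inv S′⊆S agree proper′ unique′ entering ,
                 ≤-<-trans (count-mono {P = S′} {Q = S - u} (-⊆ (S - u))) (count-remove-< S u∈S)

    module Remove (δ≥2 : 2 ≤ δ) (triangle-free : δ ≡ 2 → TriangleFree H) (no-fork : ∀ x y → ¬ Fork x y) where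
      private
        other-neighbour : ∀ {w w′} → degIn B S w ≡ δ → neighboursIn B S w w′ ≡ true →
                          ∃ λ z → (neighboursIn B S w - w′) z ≡ true
        other-neighbour {w} {w′} deg ww′ = count-positive {P = neighboursIn B S w - w′}
          (ℕ.≤-pred (subst (2 ≤_) (trans (sym deg) (count-remove (neighboursIn B S w) ww′)) δ≥2))

        x-fork : ∃ λ x → (neighboursIn B S u - v) x ≡ true
        x-fork = other-neighbour deg-u (neighboursIn-intro B {S} uv v∈S)

        y-fork : ∃ λ y → (neighboursIn B S v - u) y ≡ true
        y-fork = other-neighbour deg-v (neighboursIn-intro B {S} vu u∈S)

        y : Fin (n B)
        y = proj₁ y-fork

        only-y : ∀ {z} → (neighboursIn B S u - v) z ≡ true → z ≡ y
        only-y {z} uz = decidable-stable (z ≟ y) (λ z≢y → no-fork z y (uz , proj₂ y-fork , z≢y))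

        uy-fork : (neighboursIn B S u - v) y ≡ true
        uy-fork = subst (λ z → (neighboursIn B S u - v) z ≡ true) (only-y {proj₁ x-fork} (proj₂ x-fork))
                        (proj₂ x-fork)

        uy : adj B u y ≡ true
        uy = proj₁ (fork-end u v uy-fork)

        y∈S : S y ≡ true
        y∈S = proj₁ (proj₂ (fork-end u v uy-fork))

        vy : adj B v y ≡ true
        vy = proj₁ (fork-end v u (proj₂ y-fork))

        δ≡2 : δ ≡ 2
        δ≡2 = ≤-antisym (begin
          δ                                     ≡⟨ deg-u ⟨
          degIn B S u                           ≡⟨ count-remove (neighboursIn B S u) uv-in-S ⟩
          suc (count (neighboursIn B S u - v))  ≤⟨ s≤s (count-mono (λ {z} uz → dec-true (z ≟ y) (only-y uz))) ⟩
          suc (count (λ z → does (z ≟ y)))      ≡⟨ cong suc (count-singleton y) ⟩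
          2                                     ∎) δ≥2
          where
          open ≤-Reasoning
          uv-in-S : neighboursIn B S u v ≡ true
          uv-in-S = neighboursIn-intro B {S} uv v∈S

        entering : EnteringClash S (S - u) c
        entering copy inside {i} out with -removed S (inside i) out
        ... | φi≡u with δ-neighbour-in-copy copy inside deg-u φi≡u uv v∈S
                      | δ-neighbour-in-copy copy inside deg-u φi≡u uy y∈S
        ...   | j , ij , φj≡v | k , ik , φk≡y with δ-neighbour-in-copy copy inside deg-v φj≡v vy y∈S
        ...     | k′ , jk′ , φk′≡y = ⊥-elim (triangle-free δ≡2 ij jk ik)
          where
          jk : adj H j k ≡ true
          jk = subst (λ m → adj H j m ≡ true) (proj₁ copy k′ k (trans φk′≡y (sym φk≡y))) jk′

      progress : Progress S
      progress = S - u , c , restrict inv (-⊆ S) entering , count-remove-< S u∈S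

    tight-progress : 2 ≤ δ → (δ ≡ 2 → TriangleFree H) → Progress S
    tight-progress δ≥2 triangle-free with any? (λ x → any? (λ y → fork? x y))
    ... | yes (_ , _ , fork) = Recolour.progress fork
    ... | no  no-fork        = Remove.progress δ≥2 triangle-free (λ x y fork → no-fork (x , y , fork))

  module _ (δ≥2 : 2 ≤ δ) (triangle-free : δ ≡ 2 → TriangleFree H)
           (unstuck : ∀ {S w} → S w ≡ true → ¬ Stuck B δ S) where

    progress : ∀ {S c w} → Invariant S c → S w ≡ true → Progress S
    progress {S} {c} inv Sw with any? (λ a → (S a Bool.≟ true) ×-dec (degIn B S a ℕ.<? δ))
    ... | yes (a , Sa , low) = S - a , c , remove-low inv Sa low , count-remove-< S Sa
    ... | no  no-low with any? (λ u → any? (λ v → tight? u v))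
      where
      tight? : ∀ u v → Dec (S u ≡ true × S v ≡ true × adj B u v ≡ true × degIn B S u ≡ δ × degIn B S v ≡ δ)
      tight? u v = (S u Bool.≟ true) ×-dec (S v Bool.≟ true) ×-dec (adj B u v Bool.≟ true)
                     ×-dec (degIn B S u ℕ.≟ δ) ×-dec (degIn B S v ℕ.≟ δ)
    ...   | yes (u , v , Su , Sv , uv , du , dv) = Tight.tight-progress inv tight δ≥2 triangle-free
      where
      tight : TightEdge S
      tight = record { u = u ; v = v ; u∈S = Su ; v∈S = Sv ; uv = uv ; deg-u = du ; deg-v = dv }
    ...   | no  no-tight = ⊥-elim (unstuck Sw stuck)
      where
      stuck : Stuck B δ S
      stuck = record
        { no-low-vertex = λ {i} Si → ≮⇒≥ (λ low → no-low (i , Si , low))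
        ; no-tight-edge = λ {i} {j} Si Sj ij di dj → no-tight (i , j , Si , Sj , ij , di , dj)
        }

    peel : ∀ k {S c} → count S ≤ k → Invariant S c → ∃₂ λ S′ c′ → Invariant S′ c′ × (∀ a → S′ a ≡ false)
    peel k {S} {c} S≤k inv with any? (λ a → S a Bool.≟ true)
    ... | no empty = S , c , inv , λ a → ¬-not (λ Sa → empty (a , Sa))
    peel zero    {S} S≤k inv | yes (w , Sw) = ⊥-elim (ℕ.n≮0 (≤-trans (count-remove-< S Sw) S≤k))
    peel (suc k)     S≤k inv | yes (w , Sw) with progress inv Sw
    ... | S′ , c′ , inv′ , smaller = peel k (ℕ.≤-pred (≤-trans smaller S≤k)) inv′

    some-vertex : Fin (n H)
    some-vertex = vertex-of-positive-minDeg H (≤-trans (s≤s z≤n) δ≥2)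

    no-rainbow-copy : ∃ λ (c : Colouring B) → ProperColouring B c × ¬ RainbowCopy B H c
    no-rainbow-copy with peel (count {n B} (λ _ → true)) ≤-refl initial
    ... | _ , c , inv , empty = c , proper inv , not-rainbow
      where
      not-rainbow : ¬ RainbowCopy B H c
      not-rainbow (φ , inj , hom , rainbow) = different (rainbow i j k l ij kl same-colour)
        where open Clash (clash-outside inv (inj , hom) (some-vertex , empty (φ some-vertex)))

lemma2p10 : (H : Graph) (q : ℚ) → IsM2 H q → Strictly2Balanced H →
            1ℚ ℚ.< q → q ℚ.< bound (minDeg H) →
            (B : Graph) → MDensityAtMost B q →
            ∃ λ (c : Colouring B) → ProperColouring B c × ¬ RainbowCopy B H c
lemma2p10 H q m₂ _ 1<q q<bound B m≤q = Peeling.no-rainbow-copy H B δ≥2 triangle-free unstuck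
  where
  δ≥2 : 2 ≤ minDeg H
  δ≥2 = 1<bound⇒2≤ (minDeg H) (ℚₚ.<-trans 1<q q<bound)

  triangle-free : minDeg H ≡ 2 → TriangleFree H
  triangle-free δ≡2 = m₂<bound₂⇒triangle-free m₂ (subst (λ d → q ℚ.< bound d) δ≡2 q<bound)

  unstuck : ∀ {S w} → S w ≡ true → ¬ Stuck B (minDeg H) S
  unstuck {S} Sw stuck = <-irrefl refl (≤-<-trans (Stuck⇒dense stuck) sparse)
    where
    J : Subgraph B
    J = induced B S
    v≡count : vS J ≡ count S
    v≡count = sumFin≡sum (indicator ∘ S)
    nonempty : 1 ≤ vS J
    nonempty = subst (1 ≤_) (sym v≡count) (≤-trans (s≤s z≤n) (count-remove-< S Sw))
    sparse : suc (2 * minDeg H) * eS J < minDeg H * suc (minDeg H) * count S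
    sparse = subst (λ v → suc (2 * minDeg H) * eS J < minDeg H * suc (minDeg H) * v) v≡count
                   (density<bound⇒*< (minDeg H) (vS J) (eS J) nonempty (m≤q J nonempty) q<bound)
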